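{- Let $\sigma$ be a signature, and let $T,S$ be either two causal teams over $\sigma$ or two generalized causal teams over $\sigma$, such that $T\approx S$. Then for every formula $\varphi$ of $\mathcal{CO}[\sigma]$, of $\mathcal{CO}_{\sqcup}[\sigma]$ or of $\mathcal{COD}[\sigma]$, we have $T\models\varphi$ if and only if $S\models\varphi$.
   Context: A signature $\sigma=(\mathrm{Dom},\mathrm{Ran})$ consists of a nonempty finite set $\mathrm{Dom}$ of variables and a function $\mathrm{Ran}$ assigning to each $X\in\mathrm{Dom}$ a nonempty finite set $\mathrm{Ran}(X)$ of values. For sequences $\mathbf X=\langle X_1,\dots,X_n\rangle$ and $\mathbf x=\langle x_1,\dots,x_n\rangle$ with $x_i\in\mathrm{Ran}(X_i)$, $\mathbf X=\mathbf x$ abbreviates $X_1=x_1\wedge\dots\wedge X_n=x_n$; it is inconsistent if it contains $X=x$ and $X=x'$ with $x\neq x'$; $\mathrm{Ran}(\mathbf X)=\prod_i\mathrm{Ran}(X_i)$. An assignment is a map $s$ on $\mathrm{Dom}$ with $s(X)\in\mathrm{Ran}(X)$; $s(\mathbf X)=\langle s(X_1),\dots,s(X_n)\rangle$. A system of functions $\mathcal F$ assigns to each $V$ in a set $\mathrm{En}(\mathcal F)\subseteq\mathrm{Dom}$ a parent set $PA^{\mathcal F}_V\subseteq\mathrm{Dom}\setminus\{V\}$ and a function $\mathcal F_V:\mathrm{Ran}(PA^{\mathcal F}_V)\to\mathrm{Ran}(V)$; $\mathrm{Ex}(\mathcal F)=\mathrm{Dom}\setminus\mathrm{En}(\mathcal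 F)$; $\mathcal F$ is recursive if the graph with edges $X\to Y$ for $X\in PA^{\mathcal F}_Y$ is acyclic; $s$ is compatible with $\mathcal F$ if $s(V)=\mathcal F_V(s(PA^{\mathcal F}_V))$ for $V\in\mathrm{En}(\mathcal F)$. A causal team is a pair $T=(T^-,\mathcal F)$, $\mathcal F$ recursive, $T^-$ a set of assignments compatible with $\mathcal F$ (all such pairs with $T^-=\emptyset$ identified as the empty team $\emptyset$); its causal subteams are $(S^-,\mathcal F)$ with $S^-\subseteq T^-$. A generalized causal team is a set $T$ of pairs $(s,\mathcal F)$ with $\mathcal F$ recursive and $s$ compatible with $\mathcal F$; $T^-=\{s:(s,\mathcal F)\in T\}$; subteams are subsets. Intervention for consistent $\mathbf X=\mathbf x$: $\mathcal F_{\mathbf X=\mathbf x}$ restricts $\mathcal F$ to $\mathrm{En}(\mathcal F)\setminus\mathbf X$; $s^{\mathcal F}_{\mathbf X=\mathbf x}$ takes value $x_i$ on $X_i$, $s(V)$ on $V\in\mathrm{Ex}(\mathcal F)\setminus\mathbf X$, and recursively $\mathcal F_V(s^{\mathcal F}_{\mathbf X=\mathbf x}(PA^{\mathcal F}_V))$ on $V\in\mathrm{En}(\mathcal F)\setminus\mathbf X$; $(T^-,\mathcal F)_{\mathbf X=\mathbf x}=(\{s^{\mathcal F}_{\mathbf X=\mathbf x}:s\in T^-\},\mathcal F_{\mathbf X=\mathbf x})$; for generalized $T$, $T_{\mathbf X=\mathbf x}=\{(s^{\mathcal F}_{\mathbf X=\mathbf x},\mathcal F_{\mathbf X=\mathbf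 x}):(s,\mathcal F)\in T\}$. Languages ($\Box\!\!\rightarrow$ the counterfactual, $\sqcup$ the global disjunction): $\mathcal{CO}[\sigma]$: $\alpha::=X=x\mid\neg\alpha\mid\alpha\wedge\alpha\mid\alpha\vee\alpha\mid\mathbf X=\mathbf x\;\Box\!\!\rightarrow\alpha$; $\mathcal{CO}_{\sqcup}[\sigma]$: $\varphi::=X=x\mid\neg\alpha\mid\varphi\wedge\varphi\mid\varphi\vee\varphi\mid\varphi\sqcup\varphi\mid\mathbf X=\mathbf x\;\Box\!\!\rightarrow\varphi$; $\mathcal{COD}[\sigma]$: $\varphi::=X=x\mid{=}(\mathbf X;Y)\mid\neg\alpha\mid\varphi\wedge\varphi\mid\varphi\vee\varphi\mid\mathbf X=\mathbf x\;\Box\!\!\rightarrow\varphi$, with $\alpha\in\mathcal{CO}[\sigma]$. Semantics on causal $T=(T^-,\mathcal F)$: $T\models X=x$ iff $s(X)=x$ for all $s\in T^-$; $T\models{=}(\mathbf X;Y)$ iff any $s,s'\in T^-$ with $s(\mathbf X)=s'(\mathbf X)$ have $s(Y)=s'(Y)$; $T\models\neg\alpha$ iff $(\{s\},\mathcal F)\not\models\alpha$ for all $s\in T^-$; $\wedge$ as usual; $T\models\varphi\vee\psi$ iff there are subteams $T_1,T_2$ with $T_1^-\cup T_2^-=T^-$, $T_1\models\varphi$, $T_2\models\psi$; $T\models\varphi\sqcup\psi$ iff $T\models\varphi$ or $T\models\psi$; $T\models\mathbf X=\mathbf x\;\Box\!\!\rightarrow\varphi$ iff $\mathbf X=\mathbf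 x$ inconsistent or $T_{\mathbf X=\mathbf x}\models\varphi$. Generalized: same, with $T^-$ as team component, $T\models\neg\alpha$ iff $\{(s,\mathcal F)\}\not\models\alpha$ for all $(s,\mathcal F)\in T$, and $T\models\varphi\vee\psi$ iff $T=T_1\cup T_2$ with $T_1\models\varphi,T_2\models\psi$. Equivalence: for systems $\mathcal F,\mathcal G$ and $V$, $\mathcal F_V\sim\mathcal G_V$ iff $\mathcal F_V(\mathbf x\mathbf y)=\mathcal G_V(\mathbf x\mathbf z)$ for all $\mathbf x\in\mathrm{Ran}(PA^{\mathcal F}_V\cap PA^{\mathcal G}_V)$, $\mathbf y\in\mathrm{Ran}(PA^{\mathcal F}_V\setminus PA^{\mathcal G}_V)$, $\mathbf z\in\mathrm{Ran}(PA^{\mathcal G}_V\setminus PA^{\mathcal F}_V)$; $\mathrm{Cn}(\mathcal F)$ is the set of $V\in\mathrm{En}(\mathcal F)$ with $\mathcal F_V$ constant; $\mathcal F\sim\mathcal G$ iff $\mathrm{En}(\mathcal F)\setminus\mathrm{Cn}(\mathcal F)=\mathrm{En}(\mathcal G)\setminus\mathrm{Cn}(\mathcal G)$ and $\mathcal F_V\sim\mathcal G_V$ for all such $V$. Nonempty causal teams satisfy $(T^-,\mathcal F)\approx(S^-,\mathcal G)$ iff $T^-=S^-$ and $\mathcal F\sim\mathcal G$. For a generalized causal team $T$, $T^{\mathcal F}=\{(s,\mathcal G)\in T:\mathcal G\sim\mathcal F\}$, and generalized $S\approx T$ iff $(S^{\mathcal F})^-=(T^{\mathcal F})^-$ for every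 system of functions $\mathcal F$ over $\sigma$. -}

module Defs where

open import Level using (Level; 0ℓ) renaming (suc to lsuc)
open import Data.Nat using (ℕ; suc)
open import Data.Fin using (Fin; _≟_)
open import Data.Bool using (Bool; true; false; _∧_; not)
open import Data.List using (List)
open import Data.Bool.ListAction using (any)
open import Data.List.Relation.Unary.All using (All)
open import Data.List.Membership.Propositional using (_∈_)
open import Data.Product using (Σ; ∃; ∃-syntax; _×_; _,_; proj₁; proj₂)
open import Data.Sum using (_⊎_)
open import Relation.Nullary using (¬_)
open import Relation.Nullary.Decidable using (⌊_⌋)
open import Relation.Binary.PropositionalEquality using (_≡_; _≢_)
open import Function.Bundles using (_⇔_)

-- Signatures: Dom = Fin (suc n) (nonempty, finite);
-- Ran(X) = Fin (suc (ran X)) (nonempty, finite).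

record Signature : Set where
  field
    n   : ℕ
    ran : Fin (suc n) → ℕ

module _ (σ : Signature) where
  open Signature σ

  Dom : Set
  Dom = Fin (suc n)

  Val : Dom → Set
  Val X = Fin (suc (ran X))

  Asg : Set
  Asg = (X : Dom) → Val X

  -- a sequence X = x  (list of pairs X_i = x_i, x_i ∈ Ran(X_i))
  Intv : Set
  Intv = List (Σ Dom Val)

  Consistent : Intv → Set
  Consistent L = ∀ p q → p ∈ L → q ∈ L → proj₁ p ≡ proj₁ q → p ≡ q

  inVars : Intv → Dom → Bool
  inVars L V = any (λ p → ⌊ proj₁ p ≟ V ⌋) L

  -- En(F) is given by 'en'; PA_V by 'pa V'.
  -- F_V : Ran(PA_V) → Ran(V) is represented as a function on whole
  -- assignments that depends only on the values of the parents of V.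
  -- (pa/fn on exogenous V are irrelevant junk.)

  record SysF : Set where
    field
      en        : Dom → Bool
      pa        : Dom → Dom → Bool
      pa-irrefl : ∀ V → pa V V ≡ false
      fn        : (V : Dom) → Asg → Val V
      fn-local  : ∀ V (s s' : Asg) → (∀ W → pa V W ≡ true → s W ≡ s' W)
                  → fn V s ≡ fn V s'
  open SysF public

  data Reach (F : SysF) : Dom → Dom → Set where
    edge  : ∀ {W V} → en F V ≡ true → pa F V W ≡ true → Reach F W V
    trans : ∀ {U W V} → Reach F U W → Reach F W V → Reach F U V

  Recursive : SysF → Set
  Recursive F = ∀ V → ¬ Reach F V V

  Compatible : SysF → Asg → Set
  Compatible F s = ∀ V → en F V ≡ true → s V ≡ fn F V s

  intervSys : SysF → Intv → SysF
  intervSys F L = record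
    { en = λ V → en F V ∧ not (inVars L V)
    ; pa = pa F ; pa-irrefl = pa-irrefl F
    ; fn = fn F ; fn-local = fn-local F }

  -- t = s^F_{X=x}: the defining (recursive) equations of the intervened
  -- assignment, stated relationally (unique solution for recursive F).
  Intervened : SysF → Intv → Asg → Asg → Set
  Intervened F L s t =
    (∀ p → p ∈ L → t (proj₁ p) ≡ proj₂ p) ×
    (∀ V → inVars L V ≡ false →
       (en F V ≡ true → t V ≡ fn F V t) × (en F V ≡ false → t V ≡ s V))

  Constant : SysF → Dom → Set
  Constant F V = ∀ (s s' : Asg) → fn F V s ≡ fn F V s'

  EnNC : SysF → Dom → Set
  EnNC F V = en F V ≡ true × ¬ Constant F V

  _∼at_ : SysF → SysF → Dom → Set
  (F ∼at G) V = ∀ (s s' : Asg) →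
    (∀ W → pa F V W ≡ true → pa G V W ≡ true → s W ≡ s' W) →
    fn F V s ≡ fn G V s'

  _∼_ : SysF → SysF → Set
  F ∼ G = (∀ V → EnNC F V ⇔ EnNC G V) × (∀ V → EnNC F V → (F ∼at G) V)

  -- Languages.  Fml u d : u = global disjunction allowed,
  -- d = dependence atoms allowed.

  data Fml : Bool → Bool → Set where
    eq  : ∀ {u d} (X : Dom) → Val X → Fml u d
    dep : ∀ {u} → List Dom → Dom → Fml u true
    neg : ∀ {u d} → Fml false false → Fml u d
    _∧'_ : ∀ {u d} → Fml u d → Fml u d → Fml u d
    _∨'_ : ∀ {u d} → Fml u d → Fml u d → Fml u d
    _⊔'_ : ∀ {d} → Fml true d → Fml true d → Fml true d
    _□→_ : ∀ {u d} → Intv → Fml u d → Fml u d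

  CO : Set
  CO = Fml false false

  COU : Set
  COU = Fml true false

  COD : Set
  COD = Fml false true

  Pred : Set → Set₁
  Pred A = A → Set

  record CTeam : Set₁ where
    field
      tm     : Pred Asg
      sys    : SysF
      rec    : Recursive sys
      compat : ∀ s → tm s → Compatible sys s
  open CTeam public

  csat : ∀ {u d} → Pred Asg → SysF → Fml u d → Set₁
  csat P F (eq X x) = Level.Lift (lsuc 0ℓ) (∀ s → P s → s X ≡ x)
  csat P F (dep Xs Y) = Level.Lift (lsuc 0ℓ)
    (∀ s s' → P s → P s' → All (λ X → s X ≡ s' X) Xs → s Y ≡ s' Y)
  csat P F (neg α) = ∀ s → P s → ¬ csat (λ t → t ≡ s) F α
  csat P F (φ ∧' ψ) = csat P F φ × csat P F ψ
  csat P F (φ ∨' ψ) = ∃[ P₁ ] ∃[ P₂ ]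
    ((∀ s → P s ⇔ (P₁ s ⊎ P₂ s)) × csat P₁ F φ × csat P₂ F ψ)
  csat P F (φ ⊔' ψ) = csat P F φ ⊎ csat P F ψ
  csat P F (L □→ φ) = Level.Lift (lsuc 0ℓ) (¬ Consistent L) ⊎
    csat (λ t → ∃[ s ] (P s × Intervened F L s t)) (intervSys F L) φ

  _⊨_ : ∀ {u d} → CTeam → Fml u d → Set₁
  T ⊨ φ = csat (tm T) (sys T) φ

  -- (T⁻,F) ≈ (S⁻,G): equal team components, and either both empty
  -- (identified as the empty team) or F ∼ G.
  _≈_ : CTeam → CTeam → Set
  T ≈ S = (∀ s → tm T s ⇔ tm S s) × ((∀ s → ¬ tm T s) ⊎ sys T ∼ sys S)

  record GTeam : Set₁ where
    field
      gm    : Pred (Asg × SysF)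
      gwf   : ∀ s F → gm (s , F) → Recursive F × Compatible F s
  open GTeam public

  gsat : ∀ {u d} → Pred (Asg × SysF) → Fml u d → Set₁
  gsat P (eq X x) = Level.Lift (lsuc 0ℓ) (∀ s F → P (s , F) → s X ≡ x)
  gsat P (dep Xs Y) = Level.Lift (lsuc 0ℓ)
    (∀ s F s' F' → P (s , F) → P (s' , F') →
      All (λ X → s X ≡ s' X) Xs → s Y ≡ s' Y)
  gsat P (neg α) = ∀ s F → P (s , F) → ¬ gsat (λ q → q ≡ (s , F)) α
  gsat P (φ ∧' ψ) = gsat P φ × gsat P ψ
  gsat P (φ ∨' ψ) = ∃[ P₁ ] ∃[ P₂ ]
    ((∀ q → P q ⇔ (P₁ q ⊎ P₂ q)) × gsat P₁ φ × gsat P₂ ψ)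
  gsat P (φ ⊔' ψ) = gsat P φ ⊎ gsat P ψ
  gsat P (L □→ φ) = Level.Lift (lsuc 0ℓ) (¬ Consistent L) ⊎
    gsat (λ q → ∃[ s ] ∃[ F ]
            (P (s , F) × Intervened F L s (proj₁ q) × proj₂ q ≡ intervSys F L)) φ

  _⊨g_ : ∀ {u d} → GTeam → Fml u d → Set₁
  T ⊨g φ = gsat (gm T) φ

  restrictTo : GTeam → SysF → Pred Asg
  restrictTo T F s = ∃[ G ] (gm T (s , G) × G ∼ F)

  _≈g_ : GTeam → GTeam → Set
  S ≈g T = ∀ (F : SysF) s → restrictTo S F s ⇔ restrictTo T F s

-- Satisfaction only ever inspects a team through its assignments and through
-- interventions, and an intervention uses an equation F_V only where it is a
-- non-constant endogenous one: at a constant equation the intervened value is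
-- the old value s(V) anyway, because s is compatible with F.  Equivalent systems
-- have the same such equations up to irrelevant parents, so they produce the
-- same intervened assignments and again equivalent systems.  An induction on
-- formulas, with "same assignments, equivalent compatible systems" as the
-- invariant, then gives the claim; for generalized teams the invariant is
-- "same assignments in every ∼-class of systems".
module Submission where

open import Defs hiding (trans; _∼_)
import Defs
open import Data.Bool using (true; false; _∧_; not; if_then_else_)
open import Data.Empty using (⊥-elim)
open import Data.Fin using (_≟_)
open import Data.List.Membership.Propositional using (_∈_)
open import Data.Product using (_×_; _,_; proj₁; proj₂; ∃-syntax)
open import Data.Sum using (_⊎_; inj₁; inj₂; [_,_])
open import Function.Bundles using (_⇔_; mk⇔; Equivalence)
import Function.Properties.Equivalence as ⇔
open import Level using (lift)
open import Relation.Nullary using (¬_; Dec)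
open import Relation.Nullary.Decidable using (decidable-stable)
open import Relation.Binary.PropositionalEquality
  using (_≡_; _≢_; refl; sym; trans)

open Equivalence using (to; from)

by-cases : ∀ {P C : Set} → Dec C → (P → C) → (¬ P → C) → C
by-cases C? if-P if-¬P = decidable-stable C? λ ¬C → ¬C (if-¬P λ p → ¬C (if-P p))

∧-not≡true⇔ : ∀ a b → a ∧ not b ≡ true ⇔ (a ≡ true × b ≡ false)
∧-not≡true⇔ true  false = mk⇔ (λ _ → refl , refl) (λ _ → refl)
∧-not≡true⇔ true  true  = mk⇔ (λ ()) (λ ())
∧-not≡true⇔ false _     = mk⇔ (λ ()) (λ ())

module _ (σ : Signature) where

  infix 4 _∼_
  _∼_ : SysF σ → SysF σ → Set
  _∼_ = Defs._∼_ σ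

  ∼-refl : ∀ F → F ∼ F
  ∼-refl F = (λ _ → ⇔.refl) , λ V _ s s' agree → fn-local F V s s' λ W p → agree W p p

  ∼-sym : ∀ F G → F ∼ G → G ∼ F
  ∼-sym F G (same-NC , same-fn) = (λ V → ⇔.sym (same-NC V)) , λ V nc s s' agree →
    sym (same-fn V (from (same-NC V) nc) s' s λ W p q → sym (agree W q p))

  splice : SysF σ → Dom σ → Asg σ → Asg σ → Asg σ
  splice F V s s' W = if pa F V W then s W else s' W

  splice-on-parents : ∀ (F : SysF σ) V (s s' : Asg σ) W →
    pa F V W ≡ true → s W ≡ splice F V s s' W
  splice-on-parents F V s s' W p with pa F V W
  splice-on-parents F V s s' W refl | true = refl

  splice-off-common-parents : ∀ (F H : SysF σ) V (s s' : Asg σ) W →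
    (∀ W → pa F V W ≡ true → pa H V W ≡ true → s W ≡ s' W) →
    pa H V W ≡ true → splice F V s s' W ≡ s' W
  splice-off-common-parents F H V s s' W agree q with pa F V W in p
  ... | true  = agree W p q
  ... | false = refl

  ∼-trans : ∀ F G H → F ∼ G → G ∼ H → F ∼ H
  ∼-trans F G H (NC₁ , fn₁) (NC₂ , fn₂) = (λ V → ⇔.trans (NC₁ V) (NC₂ V)) ,
    λ V nc s s' agree →
      trans (fn₁ V nc s (splice F V s s') λ W p _ → splice-on-parents F V s s' W p)
            (fn₂ V (to (NC₁ V) nc) (splice F V s s') s' λ W _ q →
               splice-off-common-parents F H V s s' W agree q)

  EnNC-intervSys : ∀ (F : SysF σ) L V →
    EnNC σ (intervSys σ F L) V ⇔ (EnNC σ F V × inVars σ L V ≡ false)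
  EnNC-intervSys F L V = mk⇔
    (λ (en , nc) → let (en-F , free) = to (∧-not≡true⇔ _ _) en in (en-F , nc) , free)
    (λ ((en-F , nc) , free) → from (∧-not≡true⇔ _ _) (en-F , free) , nc)

  intervSys-resp-∼ : ∀ F G L → F ∼ G → intervSys σ F L ∼ intervSys σ G L
  intervSys-resp-∼ F G L (same-NC , same-fn) =
    (λ V → ⇔.trans (EnNC-intervSys F L V)
             (⇔.trans (mk⇔ (λ (nc , free) → to (same-NC V) nc , free)
                           (λ (nc , free) → from (same-NC V) nc , free))
                      (⇔.sym (EnNC-intervSys G L V)))) ,
    λ V nc → same-fn V (proj₁ (to (EnNC-intervSys F L V) nc))

  IntervenedNC : SysF σ → Intv σ → Asg σ → Asg σ → Set
  IntervenedNC F L s t =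
    (∀ p → p ∈ L → t (proj₁ p) ≡ proj₂ p) ×
    (∀ V → inVars σ L V ≡ false →
       (EnNC σ F V → t V ≡ fn F V t) × (¬ EnNC σ F V → t V ≡ s V))

  constant-equation-keeps-value : ∀ F s → Compatible σ F s →
    ∀ V t → en F V ≡ true → Constant σ F V → fn F V t ≡ s V
  constant-equation-keeps-value F s compatible V t en constant =
    trans (constant t _) (sym (compatible V en))

  Intervened⇒IntervenedNC : ∀ F L s t → Compatible σ F s →
    Intervened σ F L s t → IntervenedNC F L s t
  Intervened⇒IntervenedNC F L s t compatible (assigned , equations) =
    assigned , λ V free →
      let (solves , keeps) = equations V free in
      (λ (en , _) → solves en) , keeps-value V solves keeps
    where
    keeps-value : ∀ V → (en F V ≡ true → t V ≡ fn F V t) →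
      (en F V ≡ false → t V ≡ s V) → ¬ EnNC σ F V → t V ≡ s V
    keeps-value V solves keeps ¬nc with en F V in endogenous
    ... | false = keeps refl
    ... | true  = decidable-stable (t V ≟ s V) λ t≢s → ¬nc (refl , λ constant →
      t≢s (trans (solves refl)
        (constant-equation-keeps-value F s compatible V t endogenous constant)))

  IntervenedNC⇒Intervened : ∀ F L s t → Compatible σ F s →
    IntervenedNC F L s t → Intervened σ F L s t
  IntervenedNC⇒Intervened F L s t compatible (assigned , equations) =
    assigned , λ V free →
      let (solves , keeps) = equations V free in
      (λ en → by-cases (t V ≟ fn F V t)
         (λ constant → trans (keeps λ (_ , ¬constant) → ¬constant constant)
           (sym (constant-equation-keeps-value F s compatible V t en constant)))
         (λ ¬constant → solves (en , ¬constant))) ,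
      (λ ¬en → keeps λ (en , _) → ⊥-elim (true≢false (trans (sym en) ¬en)))
    where
    true≢false : true ≢ false
    true≢false ()

  IntervenedNC-resp-∼ : ∀ F G L s t → F ∼ G →
    IntervenedNC F L s t → IntervenedNC G L s t
  IntervenedNC-resp-∼ F G L s t (same-NC , same-fn) (assigned , equations) =
    assigned , λ V free →
      let (solves , keeps) = equations V free in
      (λ nc → let nc-F = from (same-NC V) nc in
         trans (solves nc-F) (same-fn V nc-F t t λ _ _ _ → refl)) ,
      (λ ¬nc → keeps λ nc-F → ¬nc (to (same-NC V) nc-F))

  Intervened-resp-∼ : ∀ F G L s t → F ∼ G → Compatible σ F s → Compatible σ G s →
    Intervened σ F L s t → Intervened σ G L s t
  Intervened-resp-∼ F G L s t F∼G compatible-F compatible-G intervened =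
    IntervenedNC⇒Intervened G L s t compatible-G
      (IntervenedNC-resp-∼ F G L s t F∼G
        (Intervened⇒IntervenedNC F L s t compatible-F intervened))

  intervSys-compatible : ∀ F L s t → Intervened σ F L s t →
    Compatible σ (intervSys σ F L) t
  intervSys-compatible F L s t (_ , equations) V en =
    let (en-F , free) = to (∧-not≡true⇔ _ _) en in proj₁ (equations V free) en-F

  intervene : Pred σ (Asg σ) → SysF σ → Intv σ → Pred σ (Asg σ)
  intervene P F L t = ∃[ s ] (P s × Intervened σ F L s t)

  -- (P , F) ≈ (Q , G) together with compatibility, which csat does not record.
  record Similar (P Q : Pred σ (Asg σ)) (F G : SysF σ) : Set where
    constructor similar
    field
      same-assignments : ∀ s → P s ⇔ Q s
      empty-or-∼ : (∀ s → ¬ P s) ⊎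
                   (F ∼ G × (∀ s → P s → Compatible σ F s × Compatible σ G s))

  Similar-sym : ∀ {P Q F G} → Similar P Q F G → Similar Q P G F
  Similar-sym (similar same (inj₁ empty)) =
    similar (λ s → ⇔.sym (same s)) (inj₁ λ s q → empty s (from (same s) q))
  Similar-sym {F = F} {G} (similar same (inj₂ (F∼G , compatible))) =
    similar (λ s → ⇔.sym (same s)) (inj₂ (∼-sym F G F∼G , λ s q →
      let (compatible-F , compatible-G) = compatible s (from (same s) q) in
      compatible-G , compatible-F))

  Similar-subteam : ∀ {P Q F G} P₁ → (∀ s → P₁ s → P s) → Similar P Q F G →
    Similar P₁ P₁ F G
  Similar-subteam P₁ P₁⊆P (similar _ (inj₁ empty)) =
    similar (λ _ → ⇔.refl) (inj₁ λ s p → empty s (P₁⊆P s p))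
  Similar-subteam P₁ P₁⊆P (similar _ (inj₂ (F∼G , compatible))) =
    similar (λ _ → ⇔.refl) (inj₂ (F∼G , λ s p → compatible s (P₁⊆P s p)))

  Similar-intervene : ∀ {P Q F G} L → Similar P Q F G →
    Similar (intervene P F L) (intervene Q G L) (intervSys σ F L) (intervSys σ G L)
  Similar-intervene L (similar same (inj₁ empty)) =
    similar (λ t → mk⇔ (λ (s , p , _) → ⊥-elim (empty s p))
                       (λ (s , q , _) → ⊥-elim (empty s (from (same s) q))))
            (inj₁ λ t (s , p , _) → empty s p)
  Similar-intervene {P} {F = F} {G} L (similar same (inj₂ (F∼G , compatible))) =
    similar (λ t → mk⇔ (λ (s , p , i) → s , to (same s) p , forward s t p i)
                       (λ (s , q , i) → s , from (same s) q , backward s t (from (same s) q) i))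
            (inj₂ (intervSys-resp-∼ F G L F∼G , λ t (s , p , i) →
               intervSys-compatible F L s t i , intervSys-compatible G L s t (forward s t p i)))
    where
    forward : ∀ s t → P s → Intervened σ F L s t → Intervened σ G L s t
    forward s t p = let (compatible-F , compatible-G) = compatible s p in
      Intervened-resp-∼ F G L s t F∼G compatible-F compatible-G
    backward : ∀ s t → P s → Intervened σ G L s t → Intervened σ F L s t
    backward s t p = let (compatible-F , compatible-G) = compatible s p in
      Intervened-resp-∼ G F L s t (∼-sym F G F∼G) compatible-G compatible-F

  csat-transfer : ∀ {u d} (φ : Fml σ u d) {P Q F G} → Similar P Q F G →
    csat σ P F φ → csat σ Q G φ
  csat-transfer (eq X x) (similar same _) (lift holds) =
    lift λ s q → holds s (from (same s) q)
  csat-transfer (dep Xs Y) (similar same _) (lift holds) =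
    lift λ s s' q q' → holds s s' (from (same s) q) (from (same s') q')
  csat-transfer (neg α) P≃Q@(similar same _) holds s q α-at-s =
    let p = from (same s) q
        singleton≃ = Similar-subteam (_≡ s) (λ { _ refl → p }) P≃Q in
    holds s p (csat-transfer α (Similar-sym singleton≃) α-at-s)
  csat-transfer (φ ∧' ψ) P≃Q (φ-holds , ψ-holds) =
    csat-transfer φ P≃Q φ-holds , csat-transfer ψ P≃Q ψ-holds
  csat-transfer (φ ∨' ψ) P≃Q@(similar same _) (P₁ , P₂ , cover , φ-holds , ψ-holds) =
    P₁ , P₂ , (λ s → ⇔.trans (⇔.sym (same s)) (cover s)) ,
    csat-transfer φ (Similar-subteam P₁ (λ s p → from (cover s) (inj₁ p)) P≃Q) φ-holds ,
    csat-transfer ψ (Similar-subteam P₂ (λ s p → from (cover s) (inj₂ p)) P≃Q) ψ-holds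
  csat-transfer (φ ⊔' ψ) P≃Q (inj₁ φ-holds) = inj₁ (csat-transfer φ P≃Q φ-holds)
  csat-transfer (φ ⊔' ψ) P≃Q (inj₂ ψ-holds) = inj₂ (csat-transfer ψ P≃Q ψ-holds)
  csat-transfer (L □→ φ) P≃Q (inj₁ inconsistent) = inj₁ inconsistent
  csat-transfer (L □→ φ) P≃Q (inj₂ φ-holds) =
    inj₂ (csat-transfer φ (Similar-intervene L P≃Q) φ-holds)

  ≈⇒Similar : ∀ T S → _≈_ σ T S → Similar (tm T) (tm S) (sys T) (sys S)
  ≈⇒Similar T S (same , inj₁ empty) = similar same (inj₁ empty)
  ≈⇒Similar T S (same , inj₂ T∼S) = similar same (inj₂ (T∼S , λ s p →
    compat T s p , compat S s (to (same s) p)))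

  ≈⇒⊨-invariant : ∀ {u d} T S → _≈_ σ T S → (φ : Fml σ u d) →
    _⊨_ σ T φ ⇔ _⊨_ σ S φ
  ≈⇒⊨-invariant T S T≈S φ = mk⇔
    (csat-transfer φ (≈⇒Similar T S T≈S))
    (csat-transfer φ (Similar-sym (≈⇒Similar T S T≈S)))

  GPred : Set₁
  GPred = Pred σ (Asg σ × SysF σ)

  restrict : GPred → SysF σ → Pred σ (Asg σ)
  restrict P F s = ∃[ G ] (P (s , G) × G ∼ F)

  record GSimilar (P Q : GPred) : Set where
    constructor gsimilar
    field
      same-restrictions : ∀ F s → restrict P F s ⇔ restrict Q F s
      compatible-left   : ∀ s F → P (s , F) → Compatible σ F s
      compatible-right  : ∀ s F → Q (s , F) → Compatible σ F s

  GSimilar-sym : ∀ {P Q} → GSimilar P Q → GSimilar Q P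
  GSimilar-sym (gsimilar same compatible-P compatible-Q) =
    gsimilar (λ F s → ⇔.sym (same F s)) compatible-Q compatible-P

  counterpart : ∀ {P Q} → GSimilar P Q → ∀ s F → P (s , F) → restrict Q F s
  counterpart (gsimilar same _ _) s F p = to (same F s) (F , p , ∼-refl F)

  GSimilar-singleton : ∀ s F G → F ∼ G → Compatible σ F s → Compatible σ G s →
    GSimilar (_≡ (s , F)) (_≡ (s , G))
  GSimilar-singleton s F G F∼G compatible-F compatible-G = gsimilar
    (λ H t → mk⇔ (λ { (_ , refl , F∼H) → G , refl , ∼-trans G F H (∼-sym F G F∼G) F∼H })
                 (λ { (_ , refl , G∼H) → F , refl , ∼-trans F G H F∼G G∼H }))
    (λ { _ _ refl → compatible-F })
    (λ { _ _ refl → compatible-G })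

  matching : GPred → GPred → GPred
  matching Q P₁ (s , G) = Q (s , G) × restrict P₁ G s

  GSimilar-subteam : ∀ {P Q} P₁ → (∀ q → P₁ q → P q) → GSimilar P Q →
    GSimilar P₁ (matching Q P₁)
  GSimilar-subteam P₁ P₁⊆P P≃Q@(gsimilar _ compatible-P compatible-Q) = gsimilar
    (λ F s → mk⇔
      (λ (G₁ , p₁ , G₁∼F) →
         let (G , q , G∼G₁) = counterpart P≃Q s G₁ (P₁⊆P _ p₁) in
         G , (q , G₁ , p₁ , ∼-sym G G₁ G∼G₁) , ∼-trans G G₁ F G∼G₁ G₁∼F)
      (λ (G , (q , G₁ , p₁ , G₁∼G) , G∼F) → G₁ , p₁ , ∼-trans G₁ G F G₁∼G G∼F))
    (λ s F p₁ → compatible-P s F (P₁⊆P _ p₁))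
    (λ s F (q , _) → compatible-Q s F q)

  matching-cover : ∀ {P Q} P₁ P₂ → GSimilar P Q → (∀ q → P q ⇔ (P₁ q ⊎ P₂ q)) →
    ∀ q → Q q ⇔ (matching Q P₁ q ⊎ matching Q P₂ q)
  matching-cover P₁ P₂ P≃Q cover (s , G) = mk⇔
    (λ q → let (G' , p , G'∼G) = counterpart (GSimilar-sym P≃Q) s G q in
       [ (λ p₁ → inj₁ (q , G' , p₁ , G'∼G)) , (λ p₂ → inj₂ (q , G' , p₂ , G'∼G)) ]
         (to (cover (s , G')) p))
    [ proj₁ , proj₁ ]

  gintervene : GPred → Intv σ → GPred
  gintervene P L (t , H) =
    ∃[ s ] ∃[ F ] (P (s , F) × Intervened σ F L s t × H ≡ intervSys σ F L)

  gintervene-restrict : ∀ {P Q} L → GSimilar P Q → ∀ H t →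
    restrict (gintervene P L) H t → restrict (gintervene Q L) H t
  gintervene-restrict L P≃Q@(gsimilar _ compatible-P compatible-Q) H t
    (_ , (s , F , p , intervened , refl) , F[L]∼H) =
    let (G , q , G∼F) = counterpart P≃Q s F p in
    intervSys σ G L ,
    (s , G , q , Intervened-resp-∼ F G L s t (∼-sym G F G∼F)
                   (compatible-P s F p) (compatible-Q s G q) intervened , refl) ,
    ∼-trans (intervSys σ G L) (intervSys σ F L) H (intervSys-resp-∼ G F L G∼F) F[L]∼H

  GSimilar-intervene : ∀ {P Q} L → GSimilar P Q → GSimilar (gintervene P L) (gintervene Q L)
  GSimilar-intervene L P≃Q = gsimilar
    (λ H t → mk⇔ (gintervene-restrict L P≃Q H t)
                 (gintervene-restrict L (GSimilar-sym P≃Q) H t))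
    (λ { t _ (s , F , _ , intervened , refl) → intervSys-compatible F L s t intervened })
    (λ { t _ (s , F , _ , intervened , refl) → intervSys-compatible F L s t intervened })

  gsat-transfer : ∀ {u d} (φ : Fml σ u d) {P Q} → GSimilar P Q →
    gsat σ P φ → gsat σ Q φ
  gsat-transfer (eq X x) P≃Q (lift holds) = lift λ s F q →
    let (G , p , _) = counterpart (GSimilar-sym P≃Q) s F q in holds s G p
  gsat-transfer (dep Xs Y) P≃Q (lift holds) = lift λ s F s' F' q q' →
    let (G , p , _) = counterpart (GSimilar-sym P≃Q) s F q
        (G' , p' , _) = counterpart (GSimilar-sym P≃Q) s' F' q' in
    holds s G s' G' p p'
  gsat-transfer (neg α) P≃Q@(gsimilar _ compatible-P compatible-Q) holds s F q α-at-q =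
    let (G , p , G∼F) = counterpart (GSimilar-sym P≃Q) s F q in
    holds s G p (gsat-transfer α
      (GSimilar-singleton s F G (∼-sym G F G∼F) (compatible-Q s F q) (compatible-P s G p))
      α-at-q)
  gsat-transfer (φ ∧' ψ) P≃Q (φ-holds , ψ-holds) =
    gsat-transfer φ P≃Q φ-holds , gsat-transfer ψ P≃Q ψ-holds
  gsat-transfer (φ ∨' ψ) {Q = Q} P≃Q (P₁ , P₂ , cover , φ-holds , ψ-holds) =
    matching Q P₁ , matching Q P₂ , matching-cover P₁ P₂ P≃Q cover ,
    gsat-transfer φ (GSimilar-subteam P₁ (λ q p₁ → from (cover q) (inj₁ p₁)) P≃Q) φ-holds ,
    gsat-transfer ψ (GSimilar-subteam P₂ (λ q p₂ → from (cover q) (inj₂ p₂)) P≃Q) ψ-holds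
  gsat-transfer (φ ⊔' ψ) P≃Q (inj₁ φ-holds) = inj₁ (gsat-transfer φ P≃Q φ-holds)
  gsat-transfer (φ ⊔' ψ) P≃Q (inj₂ ψ-holds) = inj₂ (gsat-transfer ψ P≃Q ψ-holds)
  gsat-transfer (L □→ φ) P≃Q (inj₁ inconsistent) = inj₁ inconsistent
  gsat-transfer (L □→ φ) P≃Q (inj₂ φ-holds) =
    inj₂ (gsat-transfer φ (GSimilar-intervene L P≃Q) φ-holds)

  ≈g⇒GSimilar : ∀ T S → _≈g_ σ T S → GSimilar (gm T) (gm S)
  ≈g⇒GSimilar T S T≈S = gsimilar T≈S
    (λ s F p → proj₂ (gwf T s F p)) (λ s F p → proj₂ (gwf S s F p))

  ≈g⇒⊨g-invariant : ∀ {u d} T S → _≈g_ σ T S → (φ : Fml σ u d) →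
    _⊨g_ σ T φ ⇔ _⊨g_ σ S φ
  ≈g⇒⊨g-invariant T S T≈S φ = mk⇔
    (gsat-transfer φ (≈g⇒GSimilar T S T≈S))
    (gsat-transfer φ (GSimilar-sym (≈g⇒GSimilar T S T≈S)))

theorem3p3 : (σ : Signature) →
    (∀ (T S : CTeam σ) → _≈_ σ T S →
        (∀ (φ : CO σ) → _⊨_ σ T φ ⇔ _⊨_ σ S φ) ×
        (∀ (φ : COU σ) → _⊨_ σ T φ ⇔ _⊨_ σ S φ) ×
        (∀ (φ : COD σ) → _⊨_ σ T φ ⇔ _⊨_ σ S φ)) ×
    (∀ (T S : GTeam σ) → _≈g_ σ T S →
        (∀ (φ : CO σ) → _⊨g_ σ T φ ⇔ _⊨g_ σ S φ) ×
        (∀ (φ : COU σ) → _⊨g_ σ T φ ⇔ _⊨g_ σ S φ) ×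
        (∀ (φ : COD σ) → _⊨g_ σ T φ ⇔ _⊨g_ σ S φ))
theorem3p3 σ =
  (λ T S T≈S → ≈⇒⊨-invariant σ T S T≈S , ≈⇒⊨-invariant σ T S T≈S ,
               ≈⇒⊨-invariant σ T S T≈S) ,
  (λ T S T≈S → ≈g⇒⊨g-invariant σ T S T≈S , ≈g⇒⊨g-invariant σ T S T≈S ,
               ≈g⇒⊨g-invariant σ T S T≈S)
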